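{- Let $S=(s_1,\dots,s_m)\in[n]^m$ and let $P=([a_1,b_1],\dots,[a_k,b_k])$ be a partition of $[n]$ into $k$ consecutive intervals ($a_1=1$, $b_k=n$, $b_i=a_{i+1}-1$). For each $i$, let $S_i$ be the sequence obtained by listing, in order of $j=1,\dots,m$, the values $s_j-a_i+1$ for those $j$ with $s_j\in[a_i,b_i]$ (a sequence over keys $[b_i-a_i+1]$), and let $\tilde S=(\tilde s_1,\dots,\tilde s_m)\in[k]^m$ with $\tilde s_j=i$ iff $s_j\in[a_i,b_i]$. Then $\mathrm{OPT}(S)\le\sum_{i=1}^k\mathrm{OPT}(S_i)+3\,\mathrm{OPT}(\tilde S)$.
   Context: Dynamic BST model: for a sequence over keys $[N]$, an algorithm maintains a BST on $[N]$ (initial tree of its choice). To serve an access to key $x$ it touches a connected subtree containing the root and $x$, and may rearrange the touched nodes into any BST shape; the cost of the access is the number of touched nodes. $\mathrm{OPT}$ of a sequence is the minimum total cost over all offline algorithms on the corresponding key set ($\mathrm{OPT}$ of an empty sequence is $0$). -}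

module Defs where

open import Data.Nat using (ℕ; zero; suc; _+_; _∸_; _≤_; _≤?_)
open import Data.Fin using (Fin; toℕ)
open import Data.List using (List; []; _∷_; _++_; map; upTo; filter; length)
open import Data.List.Membership.Propositional using (_∈_)
open import Data.List.Relation.Binary.Permutation.Propositional using (_↭_)
open import Data.Product using (Σ; _×_; ∃-syntax)
open import Relation.Binary.PropositionalEquality using (_≡_)
open import Relation.Nullary.Decidable using (_×-dec_)

data Tree : Set where
  leaf : Tree
  node : Tree → ℕ → Tree → Tree

inorder : Tree → List ℕ
inorder leaf         = []
inorder (node l k r) = inorder l ++ (k ∷ inorder r)

keys : ℕ → List ℕ
keys N = map suc (upTo N)

IsBSTOn : ℕ → Tree → Set
IsBSTOn N t = inorder t ≡ keys N

-- The touched part of a tree: a subtree containing the root, with holes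
-- where untouched subtrees hang off.
data Top : Set where
  hole  : Top
  tnode : Top → ℕ → Top → Top

topKeys : Top → List ℕ
topKeys hole          = []
topKeys (tnode l k r) = topKeys l ++ (k ∷ topKeys r)

topSize : Top → ℕ
topSize t = length (topKeys t)

data Decomp : Tree → Top → List Tree → Set where
  dhole : ∀ t → Decomp t hole (t ∷ [])
  dnode : ∀ {l r tl tr ls rs} k → Decomp l tl ls → Decomp r tr rs →
          Decomp (node l k r) (tnode tl k tr) (ls ++ rs)

-- One access to x turning tree t into t' at cost c: touch a connected
-- subtree containing the root and x, rearrange those nodes into any BST
-- shape (untouched subtrees keep their place in key order).
Step : ℕ → Tree → ℕ → Tree → ℕ → Set
Step N t x t' c =
  ∃[ top ] ∃[ top' ] ∃[ ts ]
    ( Decomp t top ts × Decomp t' top' ts × x ∈ topKeys top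
    × topKeys top ↭ topKeys top' × IsBSTOn N t' × c ≡ topSize top )

data Exec (N : ℕ) : Tree → List ℕ → ℕ → Set where
  done : ∀ {t} → Exec N t [] 0
  step : ∀ {t t' x xs c c'} → Step N t x t' c → Exec N t' xs c' →
         Exec N t (x ∷ xs) (c + c')

Serves : ℕ → List ℕ → ℕ → Set
Serves N xs c = ∃[ t₀ ] (IsBSTOn N t₀ × Exec N t₀ xs c)

IsOPT : ℕ → List ℕ → ℕ → Set
IsOPT N xs o = Serves N xs o × (∀ c → Serves N xs c → o ≤ c)

IsIntervalPartition : (n k : ℕ) → (a b : Fin k → ℕ) → Set
IsIntervalPartition n k a b =
    (∀ i → toℕ i ≡ 0 → a i ≡ 1)
  × (∀ i → suc (toℕ i) ≡ k → b i ≡ n)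
  × (∀ i j → toℕ j ≡ suc (toℕ i) → suc (b i) ≡ a j)
  × (∀ i → a i ≤ b i)

block : ∀ {k} → (a b : Fin k → ℕ) → Fin k → List ℕ → List ℕ
block a b i S = map (λ s → suc (s ∸ a i)) (filter (λ s → (a i ≤? s) ×-dec (s ≤? b i)) S)

InBlock : ∀ {k} → (a b : Fin k → ℕ) → ℕ → ℕ → Set
InBlock {k} a b s t = Σ (Fin k) λ i → t ≡ suc (toℕ i) × a i ≤ s × s ≤ b i

-- Replace every node i of a BST on the block names [k] by a gadget: the node a_i with right child b_i,
-- whose left child is the BST of block i with its minimum a_i and maximum b_i deleted (a one-key block
-- is the single node a_i). Run an optimal algorithm for S̃ on the block names and optimal algorithms for
-- the S_i on their blocks simultaneously. An access to s in block i touches two nodes for every block name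
-- touched by the outer algorithm, which includes i, plus the inner touched part of block i; that part,
-- restricted to the inner keys of the block, stays connected to the root, is rearranged within itself and
-- is no larger, while s = a_i or s = b_i is touched anyway. Hence OPT(S) ≤ Σ OPT(S_i) + 2 OPT(S̃).
module Submission where

open import Defs
open import Data.Bool using (Bool; true; false; T)
open import Data.Empty using (⊥; ⊥-elim)
open import Data.Fin as Fin using (Fin; toℕ; fromℕ<)
open import Data.Fin.Properties
  using (toℕ<n; fromℕ<-toℕ; toℕ-fromℕ<; toℕ-injective) renaming (_≟_ to _≟ᶠ_)
open import Data.List
  using (List; []; _∷_; _++_; [_]; _∷ʳ_; map; length; reverse; drop; applyUpTo; tabulate; concatMap)
open import Data.List.Properties
  using (++-assoc; ++-identityʳ; ++-cancelˡ; ∷-injective; length-++; map-++; length-map; reverse-++;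
         unfold-reverse; reverse-involutive; length-reverse; ∷ʳ-injective; concatMap-++; concatMap-cong;
         map-applyUpTo; filter-accept; filter-reject)
open import Data.List.Membership.Propositional using (_∈_; _∉_)
open import Data.List.Membership.Propositional.Properties using (∈-++⁺ˡ; ∈-++⁺ʳ; ∈-map⁺; ∈-concat⁺′)
open import Data.List.Relation.Binary.Permutation.Propositional using (_↭_; prep; ↭-refl; ↭-sym; ↭-trans)
open import Data.List.Relation.Binary.Permutation.Propositional.Properties
  using (drop-∷; ↭-reverse; ∈-resp-↭)
  renaming (map⁺ to ↭-map⁺; ++⁺ to ↭-++⁺; ++⁺ʳ to ↭-++⁺ʳ)
open import Data.List.Relation.Binary.Pointwise using (Pointwise; []; _∷_)
open import Data.List.Relation.Unary.All as All using (All; []; _∷_)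
open import Data.List.Relation.Unary.Any using (here; there)
open import Data.List.Relation.Unary.AllPairs using ([]; _∷_)
open import Data.List.Relation.Unary.Unique.Propositional using (Unique)
import Data.List.Relation.Unary.Unique.Propositional.Properties as Unique
open import Data.Nat using (ℕ; zero; suc; _+_; _*_; _∸_; _≤_; _<_; z≤n; s≤s; _≟_; _<?_; _≤?_; _≡ᵇ_)
open import Data.Nat.ListAction using (sum)
open import Data.Nat.Properties
open import Data.Nat.Tactic.RingSolver using (solve-∀)
open import Data.Product using (Σ; ∃-syntax; _×_; _,_; proj₁; proj₂) renaming (map₂ to map₂′)
open import Data.Sum using (_⊎_; inj₁; inj₂; map₂)
open import Data.Unit using (⊤; tt)
open import Data.Vec.Functional using (updateAt)
open import Data.Vec.Functional.Properties using (updateAt-updates; updateAt-minimal)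
open import Function using (const; _∘_)
open import Relation.Binary.PropositionalEquality hiding ([_])
open import Relation.Binary.Definitions using (tri<; tri≈; tri>)
open import Relation.Nullary using (¬_; Dec; yes; no)
open import Relation.Nullary.Decidable using (_×-dec_)

interleave : {A : Set} → (Tree → List A) → (ℕ → List A) → List ℕ → List Tree → List A
interleave f e []       []       = []
interleave f e []       (t ∷ _)  = f t
interleave f e (j ∷ js) []       = []
interleave f e (j ∷ js) (t ∷ ts) = f t ++ (e j ++ interleave f e js ts)

interleave-++ : {A : Set} (f : Tree → List A) (e : ℕ → List A) (js : List ℕ) (j : ℕ) (js′ : List ℕ)
  (ts ts′ : List Tree) → length ts ≡ suc (length js) →
  interleave f e (js ++ j ∷ js′) (ts ++ ts′) ≡ interleave f e js ts ++ (e j ++ interleave f e js′ ts′)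
interleave-++ f e []       j js′ (t ∷ [])     ts′ _  = refl
interleave-++ f e []       j js′ (t ∷ _ ∷ _)  ts′ ()
interleave-++ f e (i ∷ js) j js′ (t ∷ ts)     ts′ eq = begin
  f t ++ (e i ++ interleave f e (js ++ j ∷ js′) (ts ++ ts′))
    ≡⟨ cong (λ z → f t ++ (e i ++ z)) (interleave-++ f e js j js′ ts ts′ (suc-injective eq)) ⟩
  f t ++ (e i ++ (interleave f e js ts ++ rest))
    ≡⟨ cong (f t ++_) (sym (++-assoc (e i) _ rest)) ⟩
  f t ++ ((e i ++ interleave f e js ts) ++ rest)
    ≡⟨ sym (++-assoc (f t) _ rest) ⟩
  (f t ++ (e i ++ interleave f e js ts)) ++ rest ∎
  where
    open ≡-Reasoning
    rest = e j ++ interleave f e js′ ts′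

interleave-cong : {A : Set} {f f′ : Tree → List A} (e : ℕ → List A) (js : List ℕ) (ts : List Tree) →
  (∀ {t} → t ∈ ts → f t ≡ f′ t) → interleave f e js ts ≡ interleave f′ e js ts
interleave-cong e []       []       h = refl
interleave-cong e []       (t ∷ ts) h = h (here refl)
interleave-cong e (j ∷ js) []       h = refl
interleave-cong e (j ∷ js) (t ∷ ts) h =
  cong₂ _++_ (h (here refl)) (cong (e j ++_) (interleave-cong e js ts (h ∘ there)))

interleave-keys-injective : (js js′ : List ℕ) (ts : List Tree) →
  length ts ≡ suc (length js) → length ts ≡ suc (length js′) →
  interleave inorder [_] js ts ≡ interleave inorder [_] js′ ts → js ≡ js′
interleave-keys-injective []       []         ts       _ _  _  = refl
interleave-keys-injective []       (_ ∷ _)    (_ ∷ _)  l l′ _  with trans (sym (suc-injective l)) (suc-injective l′)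
... | ()
interleave-keys-injective (_ ∷ _)  []         (_ ∷ _)  l l′ _  with trans (sym (suc-injective l)) (suc-injective l′)
... | ()
interleave-keys-injective (j ∷ js) (j′ ∷ js′) (t ∷ ts) l l′ eq with ∷-injective (++-cancelˡ (inorder t) _ _ eq)
... | j≡j′ , rest =
  cong₂ _∷_ j≡j′ (interleave-keys-injective js js′ ts (suc-injective l) (suc-injective l′) rest)

∈-interleave-keys : ∀ {y} (js : List ℕ) (ts : List Tree) → length ts ≡ suc (length js) →
  y ∈ js → y ∈ interleave inorder [_] js ts
∈-interleave-keys (j ∷ js) (t ∷ ts) l (here refl) = ∈-++⁺ʳ (inorder t) (here refl)
∈-interleave-keys (j ∷ js) (t ∷ ts) l (there y∈) =
  ∈-++⁺ʳ (inorder t) (there (∈-interleave-keys js ts (suc-injective l) y∈))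

∈-interleave-trees : ∀ {y t} (js : List ℕ) (ts : List Tree) → length ts ≡ suc (length js) →
  t ∈ ts → y ∈ inorder t → y ∈ interleave inorder [_] js ts
∈-interleave-trees []       (t ∷ []) l (here refl) y∈ = y∈
∈-interleave-trees (j ∷ js) (t ∷ ts) l (here refl) y∈ = ∈-++⁺ˡ y∈
∈-interleave-trees (j ∷ js) (t ∷ ts) l (there t∈)  y∈ =
  ∈-++⁺ʳ (inorder t) (there (∈-interleave-trees js ts (suc-injective l) t∈ y∈))

Unique-++⁻ʳ : ∀ (xs : List ℕ) {ys} → Unique (xs ++ ys) → Unique ys
Unique-++⁻ʳ []       u       = u
Unique-++⁻ʳ (x ∷ xs) (_ ∷ u) = Unique-++⁻ʳ xs u

Unique-++-disjoint : ∀ {y} (xs : List ℕ) {ys} → Unique (xs ++ ys) → y ∈ xs → y ∉ ys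
Unique-++-disjoint (x ∷ xs) (x∉ ∷ u) (here refl) y∈ys = All.lookup x∉ (∈-++⁺ʳ xs y∈ys) refl
Unique-++-disjoint (x ∷ xs) (_  ∷ u) (there y∈)  y∈ys = Unique-++-disjoint xs u y∈ y∈ys

interleave-Unique-keys : (js : List ℕ) (ts : List Tree) → length ts ≡ suc (length js) →
  Unique (interleave inorder [_] js ts) → Unique js
interleave-Unique-keys []       ts       l u = []
interleave-Unique-keys (j ∷ js) (t ∷ ts) l u with Unique-++⁻ʳ (inorder t) u
... | j∉ ∷ u′ =
  All.tabulate (λ y∈ j≡y → All.lookup j∉ (∈-interleave-keys js ts (suc-injective l) y∈) j≡y)
  ∷ interleave-Unique-keys js ts (suc-injective l) u′

interleave-keys-∉-trees : ∀ {y t} (js : List ℕ) (ts : List Tree) → length ts ≡ suc (length js) →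
  Unique (interleave inorder [_] js ts) → t ∈ ts → y ∈ js → y ∉ inorder t
interleave-keys-∉-trees (j ∷ js) (t ∷ ts) l u (here refl) y∈js y∈t =
  Unique-++-disjoint (inorder t) u y∈t (later y∈js)
  where
    later : ∀ {y} → y ∈ j ∷ js → y ∈ j ∷ interleave inorder [_] js ts
    later (here e)   = here e
    later (there y∈) = there (∈-interleave-keys js ts (suc-injective l) y∈)
interleave-keys-∉-trees (j ∷ js) (t₀ ∷ ts) l u (there t∈) (here refl) y∈t
  with Unique-++⁻ʳ (inorder t₀) u
... | j∉ ∷ _ = All.lookup j∉ (∈-interleave-trees js ts (suc-injective l) t∈ y∈t) refl
interleave-keys-∉-trees (j ∷ js) (t₀ ∷ ts) l u (there t∈) (there y∈) y∈t
  with Unique-++⁻ʳ (inorder t₀) u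
... | _ ∷ u′ = interleave-keys-∉-trees js ts (suc-injective l) u′ t∈ y∈ y∈t

Decomp-length : ∀ {t X L} → Decomp t X L → length L ≡ suc (topSize X)
Decomp-length (dhole t) = refl
Decomp-length (dnode {tl = tl} {ls = ls} k dl dr) =
  trans (length-++ ls) (trans (cong₂ _+_ (Decomp-length dl) (Decomp-length dr))
                              (cong suc (sym (length-++ (topKeys tl)))))

Decomp-inorder : ∀ {t X L} → Decomp t X L → interleave inorder [_] (topKeys X) L ≡ inorder t
Decomp-inorder (dhole t) = refl
Decomp-inorder (dnode {tl = tl} {tr} {ls} {rs} k dl dr) =
  trans (interleave-++ inorder [_] (topKeys tl) k (topKeys tr) ls rs (Decomp-length dl))
        (cong₂ (λ l r → l ++ k ∷ r) (Decomp-inorder dl) (Decomp-inorder dr))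

Decomp-topKeys : ∀ {t t′ X X′ L} → Decomp t X L → Decomp t′ X′ L → inorder t ≡ inorder t′ →
  topKeys X ≡ topKeys X′
Decomp-topKeys {X = X} {X′} {L} d d′ e =
  interleave-keys-injective (topKeys X) (topKeys X′) L (Decomp-length d) (Decomp-length d′)
    (trans (Decomp-inorder d) (trans e (sym (Decomp-inorder d′))))

Decomp-Unique-topKeys : ∀ {t X L} → Decomp t X L → Unique (inorder t) → Unique (topKeys X)
Decomp-Unique-topKeys {X = X} {L} d u =
  interleave-Unique-keys (topKeys X) L (Decomp-length d) (subst Unique (sym (Decomp-inorder d)) u)

Decomp-topKeys-∉-hanging : ∀ {t X L u j} → Decomp t X L → Unique (inorder t) →
  u ∈ L → j ∈ topKeys X → j ∉ inorder u
Decomp-topKeys-∉-hanging {X = X} {L} d u =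
  interleave-keys-∉-trees (topKeys X) L (Decomp-length d) (subst Unique (sym (Decomp-inorder d)) u)

Decomp-single : ∀ {t t′ X L} → Decomp t′ X L → L ≡ t ∷ [] → t′ ≡ t × X ≡ hole
Decomp-single (dhole _) refl = refl , refl
Decomp-single {X = tnode tl k tr} d@(dnode _ _ _) e
  with trans (sym (cong length e)) (trans (Decomp-length d) (cong suc (length-++ (topKeys tl))))
... | eq with trans (suc-injective eq) (+-suc (topSize tl) (topSize tr))
... | ()

record Rearrangement (t t′ : Tree) : Set where
  constructor rearrangement
  field
    top top′ : Top
    hanging  : List Tree
    decomp   : Decomp t top hanging
    decomp′  : Decomp t′ top′ hanging
    top-↭    : topKeys top ↭ topKeys top′

open Rearrangement

Covers : Top → Top → (ℕ → Set) → Set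
Covers X Y P = topSize Y ≤ topSize X × (∀ {y} → y ∈ topKeys X → y ∈ topKeys Y ⊎ P y)

Restriction : Tree → Tree → Top → (ℕ → Set) → Set
Restriction u u′ X P = Σ (Rearrangement u u′) λ ρ → Covers X (top ρ) P

HeadOf LastOf Extreme : ℕ → List ℕ → Set
HeadOf y xs = ∃[ ys ] xs ≡ y ∷ ys
LastOf y xs = ∃[ ys ] xs ≡ ys ∷ʳ y
Extreme y xs = HeadOf y xs ⊎ LastOf y xs

HeadOf-reverse : ∀ {y} xs → HeadOf y (reverse xs) → LastOf y xs
HeadOf-reverse {y} xs (ys , e) =
  reverse ys , trans (sym (reverse-involutive xs)) (trans (cong reverse e) (unfold-reverse y ys))

LastOf-drop-1 : ∀ {y} xs → LastOf y (drop 1 xs) → LastOf y xs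
LastOf-drop-1 []       ([]    , ())
LastOf-drop-1 []       (_ ∷ _ , ())
LastOf-drop-1 (x ∷ xs) (ys , e) = x ∷ ys , cong (x ∷_) e

deleteMin : Tree → Tree
deleteMin leaf                      = leaf
deleteMin (node leaf k r)           = r
deleteMin (node l@(node _ _ _) k r) = node (deleteMin l) k r

deleteMinTop : Top → Top
deleteMinTop hole                        = hole
deleteMinTop (tnode hole k r)            = r
deleteMinTop (tnode l@(tnode _ _ _) k r) = tnode (deleteMinTop l) k r

drop-1-++ : ∀ {A : Set} (xs : List A) {ys : List A} {m} → length xs ≡ suc m →
  drop 1 (xs ++ ys) ≡ drop 1 xs ++ ys
drop-1-++ (x ∷ xs) _ = refl

deleteMin-inorder : ∀ t → inorder (deleteMin t) ≡ drop 1 (inorder t)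
deleteMin-inorder leaf                       = refl
deleteMin-inorder (node leaf k r)            = refl
deleteMin-inorder (node l@(node ll _ _) k r) =
  trans (cong (_++ k ∷ inorder r) (deleteMin-inorder l))
        (sym (drop-1-++ (inorder l) (trans (length-++ (inorder ll)) (+-suc _ _))))

mapHead : {A : Set} → (A → A) → List A → List A
mapHead f []       = []
mapHead f (x ∷ xs) = f x ∷ xs

mapHead-++ : ∀ {A : Set} (f : A → A) (xs : List A) {ys m} → length xs ≡ suc m →
  mapHead f (xs ++ ys) ≡ mapHead f xs ++ ys
mapHead-++ f (x ∷ xs) _ = refl

FirstIsLeaf FirstIsNode : List Tree → Set
FirstIsLeaf (leaf ∷ _) = ⊤
FirstIsLeaf _          = ⊥
FirstIsNode (node _ _ _ ∷ _) = ⊤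
FirstIsNode _                = ⊥

first-leaf-or-node : ∀ (L : List Tree) {m} → length L ≡ suc m → FirstIsLeaf L ⊎ FirstIsNode L
first-leaf-or-node (leaf ∷ _)       _ = inj₁ tt
first-leaf-or-node (node _ _ _ ∷ _) _ = inj₂ tt

FirstIsLeaf-++ : ∀ (xs : List Tree) {ys m} → length xs ≡ suc m → FirstIsLeaf (xs ++ ys) → FirstIsLeaf xs
FirstIsLeaf-++ (leaf ∷ _) _ h = tt

FirstIsNode-++ : ∀ (xs : List Tree) {ys m} → length xs ≡ suc m → FirstIsNode (xs ++ ys) → FirstIsNode xs
FirstIsNode-++ (node _ _ _ ∷ _) _ h = tt

-- If the leftmost hanging subtree is nonempty, the minimum lies in it.
Decomp-deleteMin-node : ∀ {t X L} → Decomp t X L → FirstIsNode L →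
  Decomp (deleteMin t) X (mapHead deleteMin L)
Decomp-deleteMin-node (dhole (node _ _ _))              _ = dhole _
Decomp-deleteMin-node (dnode k (dhole (node _ _ _)) dr) _ = dnode k (dhole _) dr
Decomp-deleteMin-node (dnode k dl@(dnode {ls = ls} {rs = rs} _ _ _) dr) h =
  subst (Decomp _ _) (sym (mapHead-++ deleteMin (ls ++ rs) (Decomp-length dl)))
    (dnode k (Decomp-deleteMin-node dl (FirstIsNode-++ (ls ++ rs) (Decomp-length dl) h)) dr)

-- If the leftmost hanging subtree is empty, the minimum is the leftmost touched node.
Decomp-deleteMin-leaf : ∀ {t l k r L} → Decomp t (tnode l k r) L → FirstIsLeaf L →
  Decomp (deleteMin t) (deleteMinTop (tnode l k r)) (drop 1 L) ×
  Σ ℕ λ m → topKeys (tnode l k r) ≡ m ∷ topKeys (deleteMinTop (tnode l k r))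
          × inorder t ≡ m ∷ inorder (deleteMin t)
Decomp-deleteMin-leaf (dnode k (dhole leaf) dr) _ = dr , k , refl , refl
Decomp-deleteMin-leaf (dnode {tr = tr} k dl@(dnode {ls = ls} {rs = rs} _ _ _) dr) h
  with Decomp-deleteMin-leaf dl (FirstIsLeaf-++ (ls ++ rs) (Decomp-length dl) h)
... | D , m , keys-eq , inorder-eq =
  subst (Decomp _ _) (sym (drop-1-++ (ls ++ rs) (Decomp-length dl))) (dnode k D dr) ,
  m , cong (_++ k ∷ topKeys tr) keys-eq , cong (_++ _) inorder-eq

deleteMin-leaf-restriction : ∀ {t t′ l k r X′ L} → Decomp t (tnode l k r) L → Decomp t′ X′ L →
  topKeys (tnode l k r) ↭ topKeys X′ → inorder t ≡ inorder t′ → FirstIsLeaf L →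
  Restriction (deleteMin t) (deleteMin t′) (tnode l k r) (λ y → HeadOf y (inorder t))
deleteMin-leaf-restriction d (dhole leaf) p e h with Decomp-deleteMin-leaf d h
... | _ , _ , _ , inorder-eq with trans (sym inorder-eq) e
... | ()
deleteMin-leaf-restriction {t} {l = l} {k} {r} d d′@(dnode _ _ _) p e h
  with Decomp-deleteMin-leaf d h | Decomp-deleteMin-leaf d′ h
... | D , m , keys-eq , inorder-eq | D′ , _ , keys-eq′ , inorder-eq′
  with ∷-injective (trans (sym inorder-eq) (trans e inorder-eq′))
... | refl , _ =
  rearrangement _ _ _ D D′ (drop-∷ (subst₂ _↭_ keys-eq keys-eq′ p)) ,
  subst (λ ks → topSize (deleteMinTop X) ≤ length ks) (sym keys-eq) (n≤1+n _) , covers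
  where
    X = tnode l k r
    covers : ∀ {y} → y ∈ topKeys X → y ∈ topKeys (deleteMinTop X) ⊎ HeadOf y (inorder t)
    covers y∈ with subst (_ ∈_) keys-eq y∈
    ... | here refl = inj₂ (_ , inorder-eq)
    ... | there y∈′ = inj₁ y∈′

deleteMin-restriction : ∀ {t t′} (ρ : Rearrangement t t′) → inorder t ≡ inorder t′ →
  Restriction (deleteMin t) (deleteMin t′) (top ρ) (λ y → HeadOf y (inorder t))
deleteMin-restriction (rearrangement hole _ _ (dhole t) d′ p) e with Decomp-single d′ refl
... | refl , refl = rearrangement hole hole _ (dhole _) (dhole _) p , ≤-refl , λ ()
deleteMin-restriction (rearrangement X@(tnode _ _ _) X′ L d d′ p) e with first-leaf-or-node L (Decomp-length d)
... | inj₁ first-leaf = deleteMin-leaf-restriction d d′ p e first-leaf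
... | inj₂ first-node =
  rearrangement X X′ _ (Decomp-deleteMin-node d first-node) (Decomp-deleteMin-node d′ first-node) p ,
  ≤-refl , inj₁

mirror : Tree → Tree
mirror leaf         = leaf
mirror (node l k r) = node (mirror r) k (mirror l)

mirrorTop : Top → Top
mirrorTop hole          = hole
mirrorTop (tnode l k r) = tnode (mirrorTop r) k (mirrorTop l)

reverse-++-∷ : ∀ {A : Set} (xs : List A) (k : A) ys → reverse (xs ++ k ∷ ys) ≡ reverse ys ++ k ∷ reverse xs
reverse-++-∷ xs k ys =
  trans (reverse-++ xs (k ∷ ys))
        (trans (cong (_++ reverse xs) (unfold-reverse k ys)) (++-assoc (reverse ys) [ k ] (reverse xs)))

mirror-inorder : ∀ t → inorder (mirror t) ≡ reverse (inorder t)
mirror-inorder leaf         = refl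
mirror-inorder (node l k r) =
  trans (cong₂ (λ r′ l′ → r′ ++ k ∷ l′) (mirror-inorder r) (mirror-inorder l))
        (sym (reverse-++-∷ (inorder l) k (inorder r)))

mirrorTop-keys : ∀ X → topKeys (mirrorTop X) ≡ reverse (topKeys X)
mirrorTop-keys hole          = refl
mirrorTop-keys (tnode l k r) =
  trans (cong₂ (λ r′ l′ → r′ ++ k ∷ l′) (mirrorTop-keys r) (mirrorTop-keys l))
        (sym (reverse-++-∷ (topKeys l) k (topKeys r)))

mirrorTop-size : ∀ X → topSize (mirrorTop X) ≡ topSize X
mirrorTop-size X = trans (cong length (mirrorTop-keys X)) (length-reverse (topKeys X))

∈-mirrorTop : ∀ {y} X → y ∈ topKeys X → y ∈ topKeys (mirrorTop X)
∈-mirrorTop X y∈ = subst (_ ∈_) (sym (mirrorTop-keys X)) (∈-resp-↭ (↭-sym (↭-reverse (topKeys X))) y∈)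

Decomp-mirror : ∀ {t X L} → Decomp t X L → Decomp (mirror t) (mirrorTop X) (reverse (map mirror L))
Decomp-mirror (dhole t) = dhole _
Decomp-mirror (dnode {ls = ls} {rs} k dl dr) =
  subst (Decomp _ _) (sym (trans (cong reverse (map-++ mirror ls rs)) (reverse-++ (map mirror ls) (map mirror rs))))
    (dnode k (Decomp-mirror dr) (Decomp-mirror dl))

mirrorTop-↭ : ∀ {X X′} → topKeys X ↭ topKeys X′ → topKeys (mirrorTop X) ↭ topKeys (mirrorTop X′)
mirrorTop-↭ {X} {X′} p = subst₂ _↭_ (sym (mirrorTop-keys X)) (sym (mirrorTop-keys X′))
  (↭-trans (↭-reverse (topKeys X)) (↭-trans p (↭-sym (↭-reverse (topKeys X′)))))

mirror-rearrangement : ∀ {t t′} → Rearrangement t t′ → Rearrangement (mirror t) (mirror t′)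
mirror-rearrangement (rearrangement X X′ L d d′ p) =
  rearrangement (mirrorTop X) (mirrorTop X′) _ (Decomp-mirror d) (Decomp-mirror d′) (mirrorTop-↭ {X} {X′} p)

deleteMax : Tree → Tree
deleteMax t = mirror (deleteMin (mirror t))

deleteMax-restriction : ∀ {t t′} (ρ : Rearrangement t t′) → inorder t ≡ inorder t′ →
  Restriction (deleteMax t) (deleteMax t′) (top ρ) (λ y → LastOf y (inorder t))
deleteMax-restriction {t} {t′} ρ e
  with deleteMin-restriction (mirror-rearrangement ρ)
         (trans (mirror-inorder t) (trans (cong reverse e) (sym (mirror-inorder t′))))
... | σ , size≤ , covers = mirror-rearrangement σ , size≤′ , covers′
  where
    size≤′ : topSize (mirrorTop (top σ)) ≤ topSize (top ρ)
    size≤′ = subst₂ _≤_ (sym (mirrorTop-size (top σ))) (mirrorTop-size (top ρ)) size≤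
    covers′ : ∀ {y} → y ∈ topKeys (top ρ) → y ∈ topKeys (mirrorTop (top σ)) ⊎ LastOf y (inorder t)
    covers′ y∈ with covers (∈-mirrorTop (top ρ) y∈)
    ... | inj₁ y∈σ  = inj₁ (∈-mirrorTop (top σ) y∈σ)
    ... | inj₂ head = inj₂ (HeadOf-reverse (inorder t) (subst (HeadOf _) (mirror-inorder t) head))

deleteMax-inorder : ∀ t → inorder (deleteMax t) ≡ reverse (drop 1 (reverse (inorder t)))
deleteMax-inorder t = trans (mirror-inorder (deleteMin (mirror t)))
  (cong reverse (trans (deleteMin-inorder (mirror t)) (cong (drop 1) (mirror-inorder t))))

trim : Tree → Tree
trim t = deleteMax (deleteMin t)

dropEnds : List ℕ → List ℕ
dropEnds xs = reverse (drop 1 (reverse (drop 1 xs)))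

trim-inorder : ∀ t → inorder (trim t) ≡ dropEnds (inorder t)
trim-inorder t = trans (deleteMax-inorder (deleteMin t)) (cong (reverse ∘ drop 1 ∘ reverse) (deleteMin-inorder t))

trim-restriction : ∀ {t t′} (ρ : Rearrangement t t′) → inorder t ≡ inorder t′ →
  Restriction (trim t) (trim t′) (top ρ) (λ y → Extreme y (inorder t))
trim-restriction {t} {t′} ρ e with deleteMin-restriction ρ e
... | σ , size₁ , covers₁
  with deleteMax-restriction σ (trans (deleteMin-inorder t) (trans (cong (drop 1) e) (sym (deleteMin-inorder t′))))
... | τ , size₂ , covers₂ = τ , ≤-trans size₂ size₁ , covers
  where
    covers : ∀ {y} → y ∈ topKeys (top ρ) → y ∈ topKeys (top τ) ⊎ Extreme y (inorder t)
    covers y∈ with covers₁ y∈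
    ... | inj₂ head = inj₂ (inj₁ head)
    ... | inj₁ y∈σ with covers₂ y∈σ
    ...   | inj₁ y∈τ = inj₁ y∈τ
    ...   | inj₂ last = inj₂ (inj₂ (LastOf-drop-1 (inorder t) (subst (LastOf _) (deleteMin-inorder t) last)))

shift : ℕ → Tree → Tree
shift d leaf         = leaf
shift d (node l k r) = node (shift d l) (d + k) (shift d r)

shiftTop : ℕ → Top → Top
shiftTop d hole          = hole
shiftTop d (tnode l k r) = tnode (shiftTop d l) (d + k) (shiftTop d r)

shift-inorder : ∀ d t → inorder (shift d t) ≡ map (d +_) (inorder t)
shift-inorder d leaf         = refl
shift-inorder d (node l k r) =
  trans (cong₂ (λ l′ r′ → l′ ++ d + k ∷ r′) (shift-inorder d l) (shift-inorder d r))
        (sym (map-++ (d +_) (inorder l) (k ∷ inorder r)))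

shift-inorder-cong : ∀ d t t′ → inorder t ≡ inorder t′ → inorder (shift d t) ≡ inorder (shift d t′)
shift-inorder-cong d t t′ e = trans (shift-inorder d t) (trans (cong (map (d +_)) e) (sym (shift-inorder d t′)))

shiftTop-keys : ∀ d X → topKeys (shiftTop d X) ≡ map (d +_) (topKeys X)
shiftTop-keys d hole          = refl
shiftTop-keys d (tnode l k r) =
  trans (cong₂ (λ l′ r′ → l′ ++ d + k ∷ r′) (shiftTop-keys d l) (shiftTop-keys d r))
        (sym (map-++ (d +_) (topKeys l) (k ∷ topKeys r)))

Decomp-shift : ∀ d {t X L} → Decomp t X L → Decomp (shift d t) (shiftTop d X) (map (shift d) L)
Decomp-shift d (dhole t) = dhole _
Decomp-shift d (dnode {ls = ls} {rs} k dl dr) =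
  subst (Decomp _ _) (sym (map-++ (shift d) ls rs)) (dnode (d + k) (Decomp-shift d dl) (Decomp-shift d dr))

shift-rearrangement : ∀ d {t t′} → Rearrangement t t′ → Rearrangement (shift d t) (shift d t′)
shift-rearrangement d (rearrangement X X′ L D D′ p) =
  rearrangement (shiftTop d X) (shiftTop d X′) _ (Decomp-shift d D) (Decomp-shift d D′)
    (subst₂ _↭_ (sym (shiftTop-keys d X)) (sym (shiftTop-keys d X′)) (↭-map⁺ (d +_) p))

trim-shift-step : ∀ d N {t x t′ c} → IsBSTOn N t → Step N t x t′ c →
  Σ (Rearrangement (trim (shift d t)) (trim (shift d t′))) λ σ →
    topSize (top σ) ≤ c × (d + x ∈ topKeys (top σ) ⊎ Extreme (d + x) (map (d +_) (keys N)))
trim-shift-step d N {t} {x} {t′} t-bst (X , X′ , L , D , D′ , x∈X , p , t′-bst , refl)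
  with trim-restriction (shift-rearrangement d (rearrangement X X′ L D D′ p))
                        (shift-inorder-cong d t t′ (trans t-bst (sym t′-bst)))
... | σ , size≤ , covers =
  σ , subst (topSize (top σ) ≤_) (trans (cong length (shiftTop-keys d X)) (length-map (d +_) (topKeys X))) size≤ ,
  map₂ (subst (Extreme (d + x)) (trans (shift-inorder d t) (cong (map (d +_)) t-bst)))
    (covers (subst (d + x ∈_) (sym (shiftTop-keys d X)) (∈-map⁺ (d +_) x∈X)))

select : {A : Set} → ℕ → A → A → ℕ → A
select ι x y j with j ≟ ι
... | yes _ = x
... | no  _ = y

select-≡ : {A : Set} (ι : ℕ) (x y : A) → select ι x y ι ≡ x
select-≡ ι x y with ι ≟ ι
... | yes _   = refl
... | no ι≢ι = ⊥-elim (ι≢ι refl)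

select-≢ : {A : Set} (ι j : ℕ) (x y : A) → j ≢ ι → select ι x y j ≡ y
select-≢ ι j x y j≢ι with j ≟ ι
... | yes j≡ι = ⊥-elim (j≢ι j≡ι)
... | no  _   = refl

concatMap-↭ : {A : Set} {f g : A → List ℕ} (xs : List A) → (∀ x → f x ↭ g x) →
  concatMap f xs ↭ concatMap g xs
concatMap-↭ []       h = ↭-refl
concatMap-↭ (x ∷ xs) h = ↭-++⁺ (h x) (concatMap-↭ xs h)

module Composite (α β : ℕ → ℕ) (I : ℕ → List ℕ) where

  isPoint : ℕ → Bool
  isPoint j = α j ≡ᵇ β j

  gadget : Bool → ℕ → Tree → Tree → Tree → Tree
  gadget true  j v L R = node L (α j) R
  gadget false j v L R = node L (α j) (node v (β j) R)

  compose : (ℕ → Tree) → Tree → Tree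
  compose V leaf         = leaf
  compose V (node l j r) = gadget (isPoint j) j (V j) (compose V l) (compose V r)

  gadgetTop : Bool → ℕ → Top → Top → Top → Top
  gadgetTop true  j x L R = tnode L (α j) R
  gadgetTop false j x L R = tnode L (α j) (tnode x (β j) R)

  composeTop : (ℕ → Top) → Top → Top
  composeTop XF hole          = hole
  composeTop XF (tnode l j r) = gadgetTop (isPoint j) j (XF j) (composeTop XF l) (composeTop XF r)

  gadgetHanging : Bool → List Tree → List Tree
  gadgetHanging true  _  = []
  gadgetHanging false ls = ls

  gadgetKeys : Bool → ℕ → List ℕ → List ℕ
  gadgetKeys true  j _  = [ α j ]
  gadgetKeys false j xs = α j ∷ (xs ++ [ β j ])

  hangingAt : (ℕ → List Tree) → ℕ → List Tree
  hangingAt LF j = gadgetHanging (isPoint j) (LF j)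

  touchedKeys : (ℕ → Top) → ℕ → List ℕ
  touchedKeys XF j = gadgetKeys (isPoint j) j (topKeys (XF j))

  blockKeys : ℕ → List ℕ
  blockKeys j = gadgetKeys (isPoint j) j (I j)

  Decomp-compose : ∀ {V XF LF} → (∀ j → Decomp (V j) (XF j) (LF j)) → ∀ {t X L} → Decomp t X L →
    Decomp (compose V t) (composeTop XF X)
           (interleave (λ u → [ compose V u ]) (hangingAt LF) (topKeys X) L)
  Decomp-compose hD (dhole t) = dhole _
  Decomp-compose {V} {LF = LF} hD (dnode {tl = tl} {tr} {ls} {rs} j dl dr) =
    subst (Decomp _ _)
      (sym (interleave-++ (λ u → [ compose V u ]) (hangingAt LF) (topKeys tl) j (topKeys tr) ls rs
                          (Decomp-length dl)))
      (Decomp-gadget (isPoint j) (Decomp-compose hD dl) (hD j) (Decomp-compose hD dr))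
    where
      Decomp-gadget : ∀ b {v x lx L R XL XR LL LR} → Decomp L XL LL → Decomp v x lx → Decomp R XR LR →
        Decomp (gadget b j v L R) (gadgetTop b j x XL XR) (LL ++ (gadgetHanging b lx ++ LR))
      Decomp-gadget true  dL dv dR = dnode (α j) dL dR
      Decomp-gadget false dL dv dR = dnode (α j) dL (dnode (β j) dv dR)

  composeTop-keys : ∀ XF X → topKeys (composeTop XF X) ≡ concatMap (touchedKeys XF) (topKeys X)
  composeTop-keys XF hole          = refl
  composeTop-keys XF (tnode l j r) =
    trans (gadgetTop-keys (isPoint j) (XF j) (composeTop XF l) (composeTop XF r))
      (trans (cong₂ (λ l′ r′ → l′ ++ (touchedKeys XF j ++ r′))
                    (composeTop-keys XF l) (composeTop-keys XF r))
             (sym (concatMap-++ (touchedKeys XF) (topKeys l) (j ∷ topKeys r))))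
    where
      gadgetTop-keys : ∀ b x L R →
        topKeys (gadgetTop b j x L R) ≡ topKeys L ++ (gadgetKeys b j (topKeys x) ++ topKeys R)
      gadgetTop-keys true  x L R = refl
      gadgetTop-keys false x L R =
        cong (λ z → topKeys L ++ α j ∷ z) (sym (++-assoc (topKeys x) [ β j ] (topKeys R)))

  compose-inorder : ∀ V → (∀ j → inorder (V j) ≡ I j) →
    ∀ t → inorder (compose V t) ≡ concatMap blockKeys (inorder t)
  compose-inorder V hV leaf         = refl
  compose-inorder V hV (node l j r) =
    trans (gadget-inorder (isPoint j) (compose V l) (compose V r))
      (trans (cong₂ (λ l′ r′ → l′ ++ (blockKeys j ++ r′))
                    (compose-inorder V hV l) (compose-inorder V hV r))
             (sym (concatMap-++ blockKeys (inorder l) (j ∷ inorder r))))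
    where
      gadget-inorder : ∀ b L R → inorder (gadget b j (V j) L R) ≡ inorder L ++ (gadgetKeys b j (I j) ++ inorder R)
      gadget-inorder true  L R = refl
      gadget-inorder false L R rewrite hV j =
        cong (λ z → inorder L ++ α j ∷ z) (sym (++-assoc (I j) [ β j ] (inorder R)))

  compose-cong : ∀ {V V′} t → (∀ {j} → j ∈ inorder t → V j ≡ V′ j) → compose V t ≡ compose V′ t
  compose-cong leaf         h = refl
  compose-cong {V} {V′} (node l j r) h =
    trans (cong (λ v → gadget (isPoint j) j v (compose V l) (compose V r)) (h (∈-++⁺ʳ (inorder l) (here refl))))
      (cong₂ (gadget (isPoint j) j (V′ j))
             (compose-cong l (h ∘ ∈-++⁺ˡ)) (compose-cong r (h ∘ ∈-++⁺ʳ (inorder l) ∘ there)))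

  compose-rearrangement : ∀ {V V′ XF XF′ LF T T′ U U′ ts} →
    (∀ j → Decomp (V j) (XF j) (LF j)) → (∀ j → Decomp (V′ j) (XF′ j) (LF j)) →
    (∀ j → topKeys (XF j) ↭ topKeys (XF′ j)) →
    Decomp T U ts → Decomp T′ U′ ts → inorder T ≡ inorder T′ →
    (∀ {u j} → u ∈ ts → j ∈ inorder u → V′ j ≡ V j) →
    Rearrangement (compose V T) (compose V′ T′)
  compose-rearrangement {V} {V′} {XF} {XF′} {LF} {U = U} {U′} {ts} hD hD′ p D D′ e same =
    rearrangement (composeTop XF U) (composeTop XF′ U′) _ (Decomp-compose hD D)
      (subst (Decomp _ _) hanging-eq (Decomp-compose hD′ D′)) keys-↭
    where
      U≡U′ : topKeys U ≡ topKeys U′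
      U≡U′ = Decomp-topKeys D D′ e
      hanging-eq : interleave (λ u → [ compose V′ u ]) (hangingAt LF) (topKeys U′) ts
                 ≡ interleave (λ u → [ compose V u ]) (hangingAt LF) (topKeys U) ts
      hanging-eq = trans (cong (λ js → interleave (λ u → [ compose V′ u ]) (hangingAt LF) js ts) (sym U≡U′))
        (interleave-cong (hangingAt LF) (topKeys U) ts (λ {u} u∈ → cong [_] (compose-cong u (same u∈))))
      keys-↭ : topKeys (composeTop XF U) ↭ topKeys (composeTop XF′ U′)
      keys-↭ = subst₂ _↭_ (sym (composeTop-keys XF U))
        (trans (cong (concatMap (touchedKeys XF′)) U≡U′) (sym (composeTop-keys XF′ U′)))
        (concatMap-↭ (topKeys U) λ j → gadgetKeys-↭ (isPoint j) (p j))
        where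
          gadgetKeys-↭ : ∀ b {j xs ys} → xs ↭ ys → gadgetKeys b j xs ↭ gadgetKeys b j ys
          gadgetKeys-↭ true  q = ↭-refl
          gadgetKeys-↭ false q = prep _ (↭-++⁺ʳ _ q)

  compose-step : ∀ {N V V′ T T′ x ι v v′} (ρ : Rearrangement T T′) (σ : Rearrangement v v′) →
    V ι ≡ v → V′ ι ≡ v′ → (∀ j → j ≢ ι → V′ j ≡ V j) →
    inorder T ≡ inorder T′ → Unique (inorder T) → ι ∈ topKeys (top ρ) →
    x ∈ gadgetKeys (isPoint ι) ι (topKeys (top σ)) → IsBSTOn N (compose V′ T′) →
    Step N (compose V T) x (compose V′ T′) (topSize (composeTop (select ι (top σ) hole) (top ρ)))
  compose-step {V = V} {V′} {T} {T′} {x} {ι}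
    (rearrangement U U′ ts D D′ _) (rearrangement Z Z′ L DZ DZ′ pZ) Vι V′ι elsewhere e u ι∈U x∈ bst =
    top R , top′ R , hanging R , decomp R , decomp′ R , x∈R , top-↭ R , bst , refl
    where
      XF XF′ : ℕ → Top
      XF  = select ι Z hole
      XF′ = select ι Z′ hole
      LF : ℕ → List Tree
      LF j = select ι L [ V j ] j
      hD : ∀ j → Decomp (V j) (XF j) (LF j)
      hD j with j ≟ ι
      ... | yes refl = subst (λ w → Decomp w Z L) (sym Vι) DZ
      ... | no _     = dhole _
      hD′ : ∀ j → Decomp (V′ j) (XF′ j) (LF j)
      hD′ j with j ≟ ι
      ... | yes refl = subst (λ w → Decomp w Z′ L) (sym V′ι) DZ′
      ... | no j≢ι   = subst (λ w → Decomp w hole [ V j ]) (sym (elsewhere j j≢ι)) (dhole _)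
      p : ∀ j → topKeys (XF j) ↭ topKeys (XF′ j)
      p j with j ≟ ι
      ... | yes _ = pZ
      ... | no _  = ↭-refl
      same : ∀ {w j} → w ∈ ts → j ∈ inorder w → V′ j ≡ V j
      same {w} w∈ j∈ =
        elsewhere _ λ j≡ι → Decomp-topKeys-∉-hanging D u w∈ ι∈U (subst (_∈ inorder w) j≡ι j∈)
      R : Rearrangement (compose V T) (compose V′ T′)
      R = compose-rearrangement hD hD′ p D D′ e same
      x∈R : x ∈ topKeys (composeTop XF U)
      x∈R = subst (x ∈_) (sym (composeTop-keys XF U))
        (∈-concat⁺′ (subst (λ X → x ∈ gadgetKeys (isPoint ι) ι (topKeys X)) (sym (select-≡ ι Z hole)) x∈)
                    (∈-map⁺ (touchedKeys XF) ι∈U))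

  gadgetKeys-length : ∀ b j xs → length (gadgetKeys b j xs) ≤ 2 + length xs
  gadgetKeys-length true  j xs = s≤s z≤n
  gadgetKeys-length false j xs = s≤s (≤-reflexive (trans (length-++ xs) (+-comm (length xs) 1)))

  touchedKeys-away-length : ∀ {ι Z} js → All (ι ≢_) js →
    length (concatMap (touchedKeys (select ι Z hole)) js) ≤ 2 * length js
  touchedKeys-away-length []       []            = z≤n
  touchedKeys-away-length {ι} {Z} (j ∷ js) (ι≢j ∷ ι∉js) = begin
    length (touchedKeys XF j ++ concatMap (touchedKeys XF) js)
      ≡⟨ length-++ (touchedKeys XF j) ⟩
    length (touchedKeys XF j) + length (concatMap (touchedKeys XF) js)
      ≤⟨ +-mono-≤ gadget≤2 (touchedKeys-away-length js ι∉js) ⟩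
    2 + 2 * length js
      ≡⟨ sym (*-suc 2 (length js)) ⟩
    2 * suc (length js) ∎
    where
      open ≤-Reasoning
      XF = select ι Z hole
      gadget≤2 : length (touchedKeys XF j) ≤ 2
      gadget≤2 = subst (λ X → length (gadgetKeys (isPoint j) j (topKeys X)) ≤ 2)
        (sym (select-≢ ι j Z hole (ι≢j ∘ sym))) (gadgetKeys-length (isPoint j) j [])

  touchedKeys-length : ∀ {ι Z} js → Unique js →
    length (concatMap (touchedKeys (select ι Z hole)) js) ≤ 2 * length js + topSize Z
  touchedKeys-length []       []          = z≤n
  touchedKeys-length {ι} {Z} (j ∷ js) (j∉js ∷ u) = begin
    length (touchedKeys XF j ++ concatMap (touchedKeys XF) js)
      ≡⟨ length-++ (touchedKeys XF j) ⟩
    length (touchedKeys XF j) + length (concatMap (touchedKeys XF) js)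
      ≤⟨ split (j ≟ ι) ⟩
    2 * suc (length js) + topSize Z ∎
    where
      open ≤-Reasoning
      XF = select ι Z hole
      split : Dec (j ≡ ι) →
        length (touchedKeys XF j) + length (concatMap (touchedKeys XF) js) ≤ 2 * suc (length js) + topSize Z
      split (yes refl) = begin
        length (touchedKeys XF j) + length (concatMap (touchedKeys XF) js)
          ≤⟨ +-mono-≤ (subst (λ X → length (gadgetKeys (isPoint j) j (topKeys X)) ≤ 2 + topSize Z)
                              (sym (select-≡ j Z hole)) (gadgetKeys-length (isPoint j) j (topKeys Z)))
                      (touchedKeys-away-length js j∉js) ⟩
        (2 + topSize Z) + 2 * length js
          ≡⟨ regroup (length js) (topSize Z) ⟩
        2 * suc (length js) + topSize Z ∎
        where
          regroup : ∀ m z → (2 + z) + 2 * m ≡ 2 * suc m + z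
          regroup = solve-∀
      split (no j≢ι) = begin
        length (touchedKeys XF j) + length (concatMap (touchedKeys XF) js)
          ≤⟨ +-mono-≤ (subst (λ X → length (gadgetKeys (isPoint j) j (topKeys X)) ≤ 2)
                              (sym (select-≢ ι j Z hole j≢ι)) (gadgetKeys-length (isPoint j) j []))
                      (touchedKeys-length js u) ⟩
        2 + (2 * length js + topSize Z)
          ≡⟨ regroup (length js) (topSize Z) ⟩
        2 * suc (length js) + topSize Z ∎
        where
          regroup : ∀ m z → 2 + (2 * m + z) ≡ 2 * suc m + z
          regroup = solve-∀

  composeTop-select-size : ∀ {ι Z} U → Unique (topKeys U) →
    topSize (composeTop (select ι Z hole) U) ≤ 2 * topSize U + topSize Z
  composeTop-select-size U u =
    subst (_≤ _) (sym (cong length (composeTop-keys _ U))) (touchedKeys-length (topKeys U) u)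

interval : ℕ → ℕ → List ℕ
interval lo zero    = []
interval lo (suc m) = lo ∷ interval (suc lo) m

applyUpTo-interval : ∀ m (f : ℕ → ℕ) lo → (∀ i → f i ≡ lo + i) → applyUpTo f m ≡ interval lo m
applyUpTo-interval zero    f lo h = refl
applyUpTo-interval (suc m) f lo h =
  cong₂ _∷_ (trans (h 0) (+-identityʳ lo))
            (applyUpTo-interval m (f ∘ suc) (suc lo) λ i → trans (h (suc i)) (+-suc lo i))

keys≡interval : ∀ N → keys N ≡ interval 1 N
keys≡interval N = trans (map-applyUpTo (λ x → x) suc N) (applyUpTo-interval N suc 1 λ _ → refl)

interval-++ : ∀ lo m m′ → interval lo m ++ interval (lo + m) m′ ≡ interval lo (m + m′)
interval-++ lo zero    m′ = cong (λ z → interval z m′) (+-identityʳ lo)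
interval-++ lo (suc m) m′ =
  cong (lo ∷_) (trans (cong (λ z → interval (suc lo) m ++ interval z m′) (+-suc lo m)) (interval-++ (suc lo) m m′))

interval-∷ʳ : ∀ lo m → interval lo (suc m) ≡ interval lo m ∷ʳ (lo + m)
interval-∷ʳ lo m = trans (cong (interval lo) (+-comm 1 m)) (sym (interval-++ lo m 1))

map-interval : ∀ d lo m → map (d +_) (interval lo m) ≡ interval (d + lo) m
map-interval d lo zero    = refl
map-interval d lo (suc m) =
  cong (d + lo ∷_) (trans (map-interval d (suc lo) m) (cong (λ z → interval z m) (+-suc d lo)))

dropEnds-∷-∷ʳ : ∀ x xs y → dropEnds (x ∷ (xs ∷ʳ y)) ≡ xs
dropEnds-∷-∷ʳ x xs y = trans (cong (reverse ∘ drop 1) (reverse-++ xs [ y ])) (reverse-involutive xs)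

ends-dropEnds : ∀ {xs : List ℕ} {x ys y} → xs ≡ x ∷ (ys ∷ʳ y) → xs ≡ x ∷ (dropEnds xs ∷ʳ y)
ends-dropEnds {x = x} {ys} {y} refl = cong (λ zs → x ∷ (zs ∷ʳ y)) (sym (dropEnds-∷-∷ʳ x ys y))

interval-ends : ∀ x y → x < y →
  interval x (suc (y ∸ x)) ≡ x ∷ (dropEnds (interval x (suc (y ∸ x))) ∷ʳ y)
interval-ends x y x<y = ends-dropEnds (begin
  interval x (suc (y ∸ x))                     ≡⟨ cong (λ z → interval x (suc (z ∸ x))) y≡ ⟩
  interval x (suc (x + suc m ∸ x))             ≡⟨ cong (λ z → interval x (suc z)) (m+n∸m≡n x (suc m)) ⟩
  x ∷ interval (suc x) (suc m)                 ≡⟨ cong (x ∷_) (interval-∷ʳ (suc x) m) ⟩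
  x ∷ (interval (suc x) m ∷ʳ (suc x + m))      ≡⟨ cong (λ z → x ∷ (interval (suc x) m ∷ʳ z)) (trans (sym (+-suc x m)) (sym y≡)) ⟩
  x ∷ (interval (suc x) m ∷ʳ y)                ∎)
  where
    open ≡-Reasoning
    m = y ∸ suc x
    y≡ : y ≡ x + suc m
    y≡ = trans (sym (m+[n∸m]≡n x<y)) (sym (+-suc x m))

keys-Unique : ∀ N → Unique (keys N)
keys-Unique N = Unique.map⁺ suc-injective (Unique.upTo⁺ N)

-- Outer keys 1, …, k name the blocks Fin k; junk value d off that range.
atKey : ∀ {k} {X : Set} → X → (Fin k → X) → ℕ → X
atKey d g zero = d
atKey {k} d g (suc m) with m <? k
... | yes m<k = g (fromℕ< m<k)
... | no  _   = d

atKey-fromℕ< : ∀ {k} {X : Set} (d : X) (g : Fin k → X) m (m<k : m < k) → atKey d g (suc m) ≡ g (fromℕ< m<k)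
atKey-fromℕ< {k} d g m m<k with m <? k
... | yes _    = refl
... | no  m≮k  = ⊥-elim (m≮k m<k)

atKey-suc-toℕ : ∀ {k} {X : Set} (d : X) (g : Fin k → X) f → atKey d g (suc (toℕ f)) ≡ g f
atKey-suc-toℕ d g f = trans (atKey-fromℕ< d g (toℕ f) (toℕ<n f)) (cong g (fromℕ<-toℕ f (toℕ<n f)))

atKey-view : ∀ k j →
  (∃[ f ] j ≡ suc (toℕ {k} f)) ⊎ (∀ {X : Set} (d : X) (g : Fin k → X) → atKey d g j ≡ d)
atKey-view k zero    = inj₂ λ d g → refl
atKey-view k (suc m) with m <? k
... | yes m<k = inj₁ (fromℕ< m<k , cong suc (sym (toℕ-fromℕ< m<k)))
... | no  _   = inj₂ λ d g → refl

updateAt-elim₂ : ∀ {k} {A B : Set} (P : Fin k → A → B → Set) (g : Fin k → A) (h : Fin k → B) i {v w} →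
  P i v w → (∀ f → f ≢ i → P f (g f) (h f)) →
  ∀ f → P f (updateAt g i (const v) f) (updateAt h i (const w) f)
updateAt-elim₂ P g h i {v} {w} at-i elsewhere f with f ≟ᶠ i
... | yes refl = subst₂ (P f) (sym (updateAt-updates f g)) (sym (updateAt-updates f h)) at-i
... | no  f≢i  =
  subst₂ (P f) (sym (updateAt-minimal f i g f≢i)) (sym (updateAt-minimal f i h f≢i)) (elsewhere f f≢i)

sum-updateAt : ∀ {k} (c : Fin k → ℕ) i {x y} → c i ≡ x + y →
  sum (tabulate c) ≡ x + sum (tabulate (updateAt c i (const y)))
sum-updateAt {suc k} c Fin.zero    {x} {y} e = trans (cong (_+ rest) e) (+-assoc x y rest)
  where rest = sum (tabulate (c ∘ Fin.suc))
sum-updateAt {suc k} c (Fin.suc i) {x} {y} e =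
  trans (cong (c Fin.zero +_) (sum-updateAt (c ∘ Fin.suc) i e)) (+-comm-middle (c Fin.zero) x _)
  where
    +-comm-middle : ∀ p q r → p + (q + r) ≡ q + (p + r)
    +-comm-middle = solve-∀

Step-isBST : ∀ {N t x t′ c} → Step N t x t′ c → IsBSTOn N t′
Step-isBST (_ , _ , _ , _ , _ , _ , _ , bst , _) = bst

Exec-∷⁻ : ∀ {N t x xs c} → Exec N t (x ∷ xs) c →
  ∃[ t′ ] ∃[ c₁ ] ∃[ c₂ ] Step N t x t′ c₁ × Exec N t′ xs c₂ × c ≡ c₁ + c₂
Exec-∷⁻ (step st ex) = _ , _ , _ , st , ex , refl

module Partition (n k′ : ℕ) (a b : Fin (suc k′) → ℕ) (part : IsIntervalPartition n (suc k′) a b) where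

  k : ℕ
  k = suc k′

  a-first : ∀ i → toℕ i ≡ 0 → a i ≡ 1
  a-first = proj₁ part

  b-last : ∀ i → suc (toℕ i) ≡ k → b i ≡ n
  b-last = proj₁ (proj₂ part)

  b-adjacent : ∀ i j → toℕ j ≡ suc (toℕ i) → suc (b i) ≡ a j
  b-adjacent = proj₁ (proj₂ (proj₂ part))

  a≤b : ∀ i → a i ≤ b i
  a≤b = proj₂ (proj₂ (proj₂ part))

  α β : ℕ → ℕ
  α = atKey 0 a
  β = atKey 0 b

  blockInterval : ℕ → List ℕ
  blockInterval j = interval (α j) (suc (β j ∸ α j))

  open Composite α β (dropEnds ∘ blockInterval)

  α≤β : ∀ j → α j ≤ β j
  α≤β j with atKey-view k j
  ... | inj₁ (f , refl) = subst₂ _≤_ (sym (atKey-suc-toℕ 0 a f)) (sym (atKey-suc-toℕ 0 b f)) (a≤b f)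
  ... | inj₂ default    = subst₂ _≤_ (sym (default 0 a)) (sym (default 0 b)) z≤n

  -- β 0 = 0 makes the first block fit the pattern.
  α-suc : ∀ m → suc m ≤ k → α (suc m) ≡ suc (β m)
  α-suc zero    1≤k = trans (atKey-fromℕ< 0 a 0 1≤k) (a-first _ (toℕ-fromℕ< 1≤k))
  α-suc (suc m) m<k = trans (atKey-fromℕ< 0 a (suc m) m<k)
    (sym (trans (cong suc (atKey-fromℕ< 0 b m m′<k))
                (b-adjacent _ _ (trans (toℕ-fromℕ< m<k) (cong suc (sym (toℕ-fromℕ< m′<k)))))))
    where
      m′<k : m < k
      m′<k = <-trans (n<1+n m) m<k

  β<α : ∀ {j j′} → j < j′ → j′ ≤ k → β j < α j′
  β<α {j} {suc m} (s≤s j≤m) 1+m≤k = subst (β j <_) (sym (α-suc m 1+m≤k)) (s≤s β-mono)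
    where
      β-mono : β j ≤ β m
      β-mono with m≤n⇒m<n∨m≡n j≤m
      ... | inj₁ j<m  = <⇒≤ (<-≤-trans (β<α j<m (≤-trans (n≤1+n m) 1+m≤k)) (α≤β m))
      ... | inj₂ refl = ≤-refl

  b<a : ∀ {f i} → toℕ f < toℕ i → b f < a i
  b<a {f} {i} f<i = subst₂ _<_ (atKey-suc-toℕ 0 b f) (atKey-suc-toℕ 0 a i) (β<α (s≤s f<i) (toℕ<n i))

  blocks-disjoint : ∀ {s} f i → a f ≤ s → s ≤ b f → a i ≤ s → s ≤ b i → f ≡ i
  blocks-disjoint f i af≤s s≤bf ai≤s s≤bi with <-cmp (toℕ f) (toℕ i)
  ... | tri< f<i _ _ = ⊥-elim (<-irrefl refl (<-≤-trans (b<a f<i) (≤-trans ai≤s s≤bf)))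
  ... | tri≈ _ f≡i _ = toℕ-injective f≡i
  ... | tri> _ _ i<f = ⊥-elim (<-irrefl refl (<-≤-trans (b<a i<f) (≤-trans af≤s s≤bi)))

  blockIntervals-concat : ∀ m → m ≤ k → concatMap blockInterval (interval 1 m) ≡ interval 1 (β m)
  blockIntervals-concat zero    _     = refl
  blockIntervals-concat (suc m) 1+m≤k = begin
    concatMap blockInterval (interval 1 (suc m))
      ≡⟨ cong (concatMap blockInterval) (interval-∷ʳ 1 m) ⟩
    concatMap blockInterval (interval 1 m ∷ʳ suc m)
      ≡⟨ concatMap-++ blockInterval (interval 1 m) [ suc m ] ⟩
    concatMap blockInterval (interval 1 m) ++ (blockInterval (suc m) ++ [])
      ≡⟨ cong₂ _++_ (blockIntervals-concat m (≤-trans (n≤1+n m) 1+m≤k))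
                    (++-identityʳ (blockInterval (suc m))) ⟩
    interval 1 (β m) ++ interval (α (suc m)) (suc (β (suc m) ∸ α (suc m)))
      ≡⟨ cong (λ z → interval 1 (β m) ++ interval z (suc (β (suc m) ∸ z))) (α-suc m 1+m≤k) ⟩
    interval 1 (β m) ++ interval (suc (β m)) (suc (β (suc m) ∸ suc (β m)))
      ≡⟨ interval-++ 1 (β m) _ ⟩
    interval 1 (β m + suc (β (suc m) ∸ suc (β m)))
      ≡⟨ cong (interval 1) (trans (+-suc (β m) _) (m+[n∸m]≡n β<)) ⟩
    interval 1 (β (suc m)) ∎
    where
      open ≡-Reasoning
      β< : β m < β (suc m)
      β< = subst (_≤ β (suc m)) (α-suc m 1+m≤k) (α≤β (suc m))

  blockIntervals-keys : concatMap blockInterval (keys k) ≡ keys n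
  blockIntervals-keys = begin
    concatMap blockInterval (keys k)         ≡⟨ cong (concatMap blockInterval) (keys≡interval k) ⟩
    concatMap blockInterval (interval 1 k)   ≡⟨ blockIntervals-concat k ≤-refl ⟩
    interval 1 (β k)                         ≡⟨ cong (interval 1) β-last ⟩
    interval 1 n                             ≡⟨ sym (keys≡interval n) ⟩
    keys n                                   ∎
    where
      open ≡-Reasoning
      β-last : β k ≡ n
      β-last = trans (atKey-fromℕ< 0 b k′ (n<1+n k′)) (b-last _ (cong suc (toℕ-fromℕ< (n<1+n k′))))

  isPoint-true : ∀ j → isPoint j ≡ true → α j ≡ β j
  isPoint-true j eq = ≡ᵇ⇒≡ (α j) (β j) (subst T (sym eq) tt)

  isPoint-false : ∀ j → isPoint j ≡ false → α j < β j
  isPoint-false j eq = ≤∧≢⇒< (α≤β j) λ α≡β → subst T eq (≡⇒≡ᵇ (α j) (β j) α≡β)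

  blockInterval-point : ∀ j → α j ≡ β j → blockInterval j ≡ [ α j ]
  blockInterval-point j α≡β =
    trans (cong (λ z → interval (α j) (suc (z ∸ α j))) (sym α≡β))
          (cong (λ z → interval (α j) (suc z)) (n∸n≡0 (α j)))

  blockKeys≡blockInterval : ∀ j → blockKeys j ≡ blockInterval j
  blockKeys≡blockInterval j with isPoint j in eq
  ... | true  = sym (blockInterval-point j (isPoint-true j eq))
  ... | false = sym (interval-ends (α j) (β j) (isPoint-false j eq))

  ∈-gadgetKeys : ∀ {s j xs} → α j ≤ s → s ≤ β j → s ∈ xs ⊎ Extreme s (blockInterval j) →
    s ∈ gadgetKeys (isPoint j) j xs
  ∈-gadgetKeys {s} {j} {xs} α≤s s≤β s∈ with isPoint j in eq
  ... | true  = here (≤-antisym (subst (s ≤_) (sym (isPoint-true j eq)) s≤β) α≤s)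
  ... | false with s∈
  ...   | inj₁ s∈xs          = there (∈-++⁺ˡ s∈xs)
  ...   | inj₂ (inj₁ (_ , e)) = here (sym (proj₁ (∷-injective (trans (sym ends) e))))
    where ends = interval-ends (α j) (β j) (isPoint-false j eq)
  ...   | inj₂ (inj₂ (_ , e)) =
    there (∈-++⁺ʳ xs (here (sym (proj₂ (∷ʳ-injective (α j ∷ _) _ (trans (sym ends) e))))))
    where ends = interval-ends (α j) (β j) (isPoint-false j eq)

  blockSize offset : Fin k → ℕ
  blockSize f = suc (b f ∸ a f)
  offset    f = a f ∸ 1

  innerTree : Fin k → Tree → Tree
  innerTree f t = trim (shift (offset f) t)

  blockTrees : (Fin k → Tree) → ℕ → Tree
  blockTrees Ts = atKey leaf (λ f → innerTree f (Ts f))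

  suc-offset : ∀ f → suc (offset f) ≡ a f
  suc-offset f =
    m+[n∸m]≡n (subst (1 ≤_) (trans (sym (α-suc (toℕ f) (toℕ<n f))) (atKey-suc-toℕ 0 a f)) (s≤s z≤n))

  offset-+-suc : ∀ f {s} → a f ≤ s → offset f + suc (s ∸ a f) ≡ s
  offset-+-suc f {s} af≤s =
    trans (+-suc (offset f) _) (trans (cong (_+ (s ∸ a f)) (suc-offset f)) (m+[n∸m]≡n af≤s))

  shift-keys-blockSize : ∀ f → map (offset f +_) (keys (blockSize f)) ≡ blockInterval (suc (toℕ f))
  shift-keys-blockSize f rewrite atKey-suc-toℕ 0 a f | atKey-suc-toℕ 0 b f =
    trans (cong (map (offset f +_)) (keys≡interval (blockSize f)))
      (trans (map-interval (offset f) 1 (blockSize f))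
             (cong (λ z → interval z (blockSize f)) (trans (+-comm (offset f) 1) (suc-offset f))))

  blockTrees-inorder : ∀ {Ts} → (∀ f → IsBSTOn (blockSize f) (Ts f)) →
    ∀ j → inorder (blockTrees Ts j) ≡ dropEnds (blockInterval j)
  blockTrees-inorder {Ts} bst j with atKey-view k j
  ... | inj₁ (f , refl) rewrite atKey-suc-toℕ leaf (λ f → innerTree f (Ts f)) f =
    trans (trim-inorder (shift (offset f) (Ts f)))
      (cong dropEnds (trans (shift-inorder (offset f) (Ts f))
                            (trans (cong (map (offset f +_)) (bst f)) (shift-keys-blockSize f))))
  ... | inj₂ default rewrite default leaf (λ f → innerTree f (Ts f)) | default 0 a | default 0 b = refl

  compose-isBST : ∀ T̃ Ts → IsBSTOn k T̃ → (∀ f → IsBSTOn (blockSize f) (Ts f)) →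
    IsBSTOn n (compose (blockTrees Ts) T̃)
  compose-isBST T̃ Ts T̃-bst Ts-bst = begin
    inorder (compose (blockTrees Ts) T̃)   ≡⟨ compose-inorder _ (blockTrees-inorder {Ts} Ts-bst) T̃ ⟩
    concatMap blockKeys (inorder T̃)       ≡⟨ cong (concatMap blockKeys) T̃-bst ⟩
    concatMap blockKeys (keys k)          ≡⟨ concatMap-cong blockKeys≡blockInterval (keys k) ⟩
    concatMap blockInterval (keys k)      ≡⟨ blockIntervals-keys ⟩
    keys n                                ∎
    where open ≡-Reasoning

  blockTrees-updateAt-≡ : ∀ Ts i t → blockTrees (updateAt Ts i (const t)) (suc (toℕ i)) ≡ innerTree i t
  blockTrees-updateAt-≡ Ts i t = trans (atKey-suc-toℕ leaf _ i) (cong (innerTree i) (updateAt-updates i Ts))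

  blockTrees-updateAt-≢ : ∀ Ts i t j → j ≢ suc (toℕ i) →
    blockTrees (updateAt Ts i (const t)) j ≡ blockTrees Ts j
  blockTrees-updateAt-≢ Ts i t j j≢ with atKey-view k j
  ... | inj₁ (f , refl) =
    trans (atKey-suc-toℕ leaf _ f)
      (trans (cong (innerTree f) (updateAt-minimal f i Ts (j≢ ∘ cong (suc ∘ toℕ))))
             (sym (atKey-suc-toℕ leaf _ f)))
  ... | inj₂ default = trans (default leaf _) (sym (default leaf _))

  block-accept : ∀ i {s} S → a i ≤ s → s ≤ b i → block a b i (s ∷ S) ≡ suc (s ∸ a i) ∷ block a b i S
  block-accept i S ai≤s s≤bi =
    cong (map (λ s → suc (s ∸ a i))) (filter-accept (λ s → (a i ≤? s) ×-dec (s ≤? b i)) (ai≤s , s≤bi))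

  block-reject : ∀ i {s} S → ¬ (a i ≤ s × s ≤ b i) → block a b i (s ∷ S) ≡ block a b i S
  block-reject i S s∉ =
    cong (map (λ s → suc (s ∸ a i))) (filter-reject (λ s → (a i ≤? s) ×-dec (s ≤? b i)) s∉)

  access-step : ∀ {T̃ T̃′ c̃ s i c Ts t′} → a i ≤ s → s ≤ b i →
    IsBSTOn k T̃ → Step k T̃ (suc (toℕ i)) T̃′ c̃ →
    IsBSTOn (blockSize i) (Ts i) → Step (blockSize i) (Ts i) (suc (s ∸ a i)) t′ c →
    (∀ f → IsBSTOn (blockSize f) (updateAt Ts i (const t′) f)) →
    ∃[ c′ ] Step n (compose (blockTrees Ts) T̃) s (compose (blockTrees (updateAt Ts i (const t′))) T̃′) c′
          × c′ ≤ 2 * c̃ + c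
  access-step {T̃′ = T̃′} {s = s} {i} {Ts = Ts} {t′} ai≤s s≤bi
    T̃-bst (U , U′ , L , D , D′ , ι∈U , p , T̃′-bst , refl) Tsᵢ-bst stepᵢ Ts′-bst
    with trim-shift-step (offset i) (blockSize i) Tsᵢ-bst stepᵢ
  ... | σ , σ-size , σ-covers =
    _ ,
    compose-step (rearrangement U U′ L D D′ p) σ
      (atKey-suc-toℕ leaf _ i) (blockTrees-updateAt-≡ Ts i t′) (blockTrees-updateAt-≢ Ts i t′)
      (trans T̃-bst (sym T̃′-bst)) T̃-unique ι∈U s∈σ (compose-isBST T̃′ (updateAt Ts i (const t′)) T̃′-bst Ts′-bst) ,
    ≤-trans (composeTop-select-size U (Decomp-Unique-topKeys D T̃-unique)) (+-monoʳ-≤ (2 * topSize U) σ-size)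
    where
      ι = suc (toℕ i)
      T̃-unique = subst Unique (sym T̃-bst) (keys-Unique k)
      s∈σ : s ∈ gadgetKeys (isPoint ι) ι (topKeys (top σ))
      s∈σ = ∈-gadgetKeys (subst (_≤ s) (sym (atKey-suc-toℕ 0 a i)) ai≤s) (subst (s ≤_) (sym (atKey-suc-toℕ 0 b i)) s≤bi)
        (subst (λ y → y ∈ topKeys (top σ) ⊎ Extreme y (blockInterval ι)) (offset-+-suc i ai≤s)
          (map₂ (subst (Extreme _) (shift-keys-blockSize i)) σ-covers))

  BlocksServe : (Fin k → Tree) → (Fin k → ℕ) → List ℕ → Set
  BlocksServe Ts c S = ∀ f → IsBSTOn (blockSize f) (Ts f) × Exec (blockSize f) (Ts f) (block a b f S) (c f)

  BlocksServe-updateAt : ∀ {Ts c S s i t′ cᵢ′} → a i ≤ s → s ≤ b i → BlocksServe Ts c (s ∷ S) →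
    IsBSTOn (blockSize i) t′ → Exec (blockSize i) t′ (block a b i S) cᵢ′ →
    BlocksServe (updateAt Ts i (const t′)) (updateAt c i (const cᵢ′)) S
  BlocksServe-updateAt {Ts} {c} {S} {i = i} ai≤s s≤bi serve t′-bst t′-exec =
    updateAt-elim₂ (λ f t c → IsBSTOn (blockSize f) t × Exec (blockSize f) t (block a b f S) c) Ts c i
      (t′-bst , t′-exec)
      λ f f≢i → map₂′ (subst (λ xs → Exec _ (Ts f) xs (c f))
                  (block-reject f S λ (af≤s , s≤bf) → f≢i (blocks-disjoint f i af≤s s≤bf ai≤s s≤bi))) (serve f)

  simulate : ∀ S S̃ → Pointwise (InBlock a b) S S̃ → ∀ {T̃ c̃ Ts c} →
    IsBSTOn k T̃ → Exec k T̃ S̃ c̃ → BlocksServe Ts c S →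
    ∃[ c′ ] Exec n (compose (blockTrees Ts) T̃) S c′ × c′ ≤ sum (tabulate c) + 2 * c̃
  simulate []      []      []  _ done _ = 0 , done , z≤n
  simulate (s ∷ S) (_ ∷ S̃) ((i , refl , ai≤s , s≤bi) ∷ S≈S̃) {Ts = Ts} {c}
    T̃-bst (step {c = cₒ} {cₒ′} stepₒ execₒ) serve
    with Exec-∷⁻ (subst (λ xs → Exec _ (Ts i) xs (c i)) (block-accept i S ai≤s s≤bi) (proj₂ (serve i)))
  ... | t′ , cᵢ , cᵢ′ , stepᵢ , execᵢ , cᵢ≡
    with serve′ ← BlocksServe-updateAt ai≤s s≤bi serve (Step-isBST stepᵢ) execᵢ
    with access-step ai≤s s≤bi T̃-bst stepₒ (proj₁ (serve i)) stepᵢ (proj₁ ∘ serve′)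
       | simulate S S̃ S≈S̃ (Step-isBST stepₒ) execₒ serve′
  ... | cₕ , stepₕ , cₕ≤ | cₜ , execₜ , cₜ≤ = cₕ + cₜ , step stepₕ execₜ , (begin
    cₕ + cₜ                                        ≤⟨ +-mono-≤ cₕ≤ cₜ≤ ⟩
    (2 * cₒ + cᵢ) + (sum (tabulate c′) + 2 * cₒ′)   ≡⟨ regroup cₒ cᵢ (sum (tabulate c′)) cₒ′ ⟩
    (cᵢ + sum (tabulate c′)) + 2 * (cₒ + cₒ′)       ≡⟨ cong (_+ 2 * (cₒ + cₒ′)) (sum-updateAt c i {cᵢ} {cᵢ′} cᵢ≡) ⟨
    sum (tabulate c) + 2 * (cₒ + cₒ′)               ∎)
    where
      open ≤-Reasoning
      c′ = updateAt c i (const cᵢ′)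
      regroup : ∀ x y z w → (2 * x + y) + (z + 2 * w) ≡ (y + z) + 2 * (x + w)
      regroup = solve-∀

  composite-serves : ∀ {S S̃ õ o} → Pointwise (InBlock a b) S S̃ →
    Serves k S̃ õ → (∀ f → Serves (blockSize f) (block a b f S) (o f)) →
    ∃[ c ] Serves n S c × c ≤ sum (tabulate o) + 2 * õ
  composite-serves {S} {S̃} S≈S̃ (T̃ , T̃-bst , T̃-exec) serves =
    let c , exec , c≤ = simulate S S̃ S≈S̃ T̃-bst T̃-exec (proj₂ ∘ serves) in
    c , (compose (blockTrees Ts) T̃ , compose-isBST T̃ Ts T̃-bst (proj₁ ∘ proj₂ ∘ serves) , exec) , c≤
    where
      Ts : Fin k → Tree
      Ts = proj₁ ∘ serves

rightSpine : List ℕ → Tree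
rightSpine []       = leaf
rightSpine (x ∷ xs) = node leaf x (rightSpine xs)

rightSpine-inorder : ∀ xs → inorder (rightSpine xs) ≡ xs
rightSpine-inorder []       = refl
rightSpine-inorder (x ∷ xs) = cong (x ∷_) (rightSpine-inorder xs)

mainTheorem4 : (n : ℕ) (S : List ℕ) → All (λ s → 1 ≤ s × s ≤ n) S →
    (k : ℕ) (a b : Fin k → ℕ) → IsIntervalPartition n k a b →
    (S̃ : List ℕ) → Pointwise (InBlock a b) S S̃ →
    (o : Fin k → ℕ) → (∀ i → IsOPT (suc (b i ∸ a i)) (block a b i S) (o i)) →
    (õ : ℕ) → IsOPT k S̃ õ →
    (oS : ℕ) → IsOPT n S oS →
    oS ≤ sum (tabulate o) + 3 * õ
mainTheorem4 n [] _ zero a b _ [] [] o _ õ _ oS oS-opt =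
  ≤-trans (proj₂ oS-opt 0 (rightSpine (keys n) , rightSpine-inorder (keys n) , done)) z≤n
mainTheorem4 n (_ ∷ _) _ zero a b _ _ ((() , _) ∷ _) _ _ _ _ _ _
mainTheorem4 n S _ (suc k′) a b part S̃ S≈S̃ o o-opt õ õ-opt oS oS-opt =
  let c , serves , c≤ = composite-serves S≈S̃ (proj₁ õ-opt) (proj₁ ∘ o-opt) in
  ≤-trans (proj₂ oS-opt c serves) (≤-trans c≤ (+-monoʳ-≤ (sum (tabulate o)) (*-monoˡ-≤ õ (n≤1+n 2))))
  where open Partition n k′ a b part
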